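{- For integers $r \ge 2$ and $k \ge 2r-1$, $\beta_2(k,r) = 2r-1$.
   Context: A $k$-partite graph comes with a fixed partition of its vertex set into $k$ parts (parts may be empty). For $k \ge r \ge 2$ and $1 \le i \le k-r+1$, $\beta_i(k,r)$ is the minimum number of vertices of a $K_r$-free $k$-partite graph such that, for every choice of $k-i$ of its parts, the subgraph induced by those parts contains a $K_{r-1}$. -}

module Defs where

open import Data.Nat using (ℕ; _≤_; _∸_)
open import Data.Fin using (Fin)
open import Data.Fin.Subset using (Subset; _∈_; ∣_∣)
open import Data.Bool using (Bool; true)
open import Data.Product using (Σ; ∃; _×_)
open import Relation.Binary.PropositionalEquality using (_≡_; _≢_)
open import Relation.Nullary using (¬_)

-- A k-partite graph on the vertex set Fin n: a (simple, undirected) graph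
-- together with a fixed assignment of each vertex to one of k parts
-- (parts may be empty), such that every part is an independent set.
record KPartiteGraph (k n : ℕ) : Set where
  field
    part      : Fin n → Fin k
    adj       : Fin n → Fin n → Bool
    adj-sym   : ∀ u v → adj u v ≡ adj v u
    adj-parts : ∀ u v → adj u v ≡ true → part u ≢ part v

open KPartiteGraph public

-- A copy of K_s in G: s distinct, pairwise adjacent vertices.
-- (Distinctness follows from adjacency being irreflexive, but we keep
-- the family indexed by Fin s with pairwise adjacency of distinct indices.)
IsClique : ∀ {k n} → KPartiteGraph k n → (s : ℕ) → (Fin s → Fin n) → Set
IsClique G s f = ∀ a b → a ≢ b → adj G (f a) (f b) ≡ true

HasCliqueIn : ∀ {k n} → KPartiteGraph k n → (s : ℕ) → Subset k → Set
HasCliqueIn {k} {n} G s S =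
  Σ (Fin s → Fin n) λ f → IsClique G s f × (∀ a → part G (f a) ∈ S)

KFree : ∀ {k n} → KPartiteGraph k n → ℕ → Set
KFree {k} {n} G r = ¬ (Σ (Fin r → Fin n) λ f → IsClique G r f)

BetaWitness : (i k r : ℕ) → ∀ {n} → KPartiteGraph k n → Set
BetaWitness i k r G =
  KFree G r × (∀ (S : Subset k) → ∣ S ∣ ≡ k ∸ i → HasCliqueIn G (r ∸ 1) S)

IsBeta : (i k r m : ℕ) → Set
IsBeta i k r m =
  (Σ (KPartiteGraph k m) λ G → BetaWitness i k r G)
  × (∀ n (G : KPartiteGraph k n) → BetaWitness i k r G → m ≤ n)

module Submission where

-- β₂(k, r) = 2r − 1 for r ≥ 2 and k ≥ 2r − 1.  Write r = a + 1.
--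
-- Upper bound.  Take the complement of the odd cycle C_{2a+1}, each vertex in a part
-- of its own.  Its cliques are the independent sets of the cycle, which have at most
-- a vertices; and any two vertices are avoided by one of the a-element independent
-- sets  i ↦ 2i + s + [t ≤ i]  (for suitable s, t).  Removing two parts removes at
-- most two vertices, so a K_a survives.
--
-- Lower bound.  In a witness G, removing the parts of any two vertices z, c leaves a
-- K_a, so z and c are avoided by an a-clique.  Fix z.  A Hall-type exchange argument
-- (by well-founded induction on subsets) shows that every clique S has at least |S|
-- "non-neighbours" (vertices ≠ z outside S missing some vertex of S).  Applied to an
-- a-clique avoiding z, this yields 2a vertices different from z, i.e. n ≥ 2a + 1.

open import Defs

open import Data.Nat using (ℕ; zero; suc; _+_; _*_; _∸_; _≤_; _<_; z≤n; s≤s; s≤s⁻¹; _≤?_; _≟_; ⌊_/2⌋)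
open import Data.Nat.Properties
open import Data.Bool using (Bool; true; false)
import Data.Bool as Bool
open import Data.Empty using (⊥)
open import Data.Fin using (Fin; zero; suc; toℕ; fromℕ<; inject≤; punchIn)
import Data.Fin.Properties as Fin
open import Data.Fin.Subset renaming (⊥ to ∅)
open import Data.Fin.Subset.Properties
open import Data.Fin.Subset.Induction using (⊂-wellFounded)
open import Data.Vec using ([]; _∷_; here; there; tabulate)
open import Data.Vec.Properties using (lookup∘tabulate; lookup⇒[]=; []=⇒lookup)
open import Data.Product using (Σ; ∃; ∃₂; _×_; _,_; proj₁; proj₂)
open import Data.Sum using (_⊎_; inj₁; inj₂; [_,_]′)
open import Function using (_∘_)
open import Function.Bundles using (mk⇔)
open import Function.Definitions using (Injective)
open import Induction.WellFounded using (Acc; acc)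
open import Level using (0ℓ)
open import Relation.Binary.Definitions using (tri<; tri≈; tri>)
open import Relation.Binary.PropositionalEquality
open import Relation.Nullary using (¬_; Dec; yes; no; does; contradiction)
open import Relation.Nullary.Decidable using (dec-true; does-⇔; decidable-stable; ¬?; _×-dec_; _⊎-dec_)
open import Relation.Unary using (Pred; Decidable)

private variable m n : ℕ

decided : ∀ {A : Set} (a? : Dec A) → does a? ≡ true → A
decided (yes a) _ = a
decided (no _) ()

⟦_⟧ : {P : Pred (Fin n) 0ℓ} → Decidable P → Subset n
⟦ P? ⟧ = tabulate (λ x → does (P? x))

module _ {P : Pred (Fin n) 0ℓ} (P? : Decidable P) where

  ∈⟦⟧⁺ : ∀ {x} → P x → x ∈ ⟦ P? ⟧
  ∈⟦⟧⁺ {x} px = lookup⇒[]= x _ (trans (lookup∘tabulate _ x) (dec-true (P? x) px))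

  ∈⟦⟧⁻ : ∀ {x} → x ∈ ⟦ P? ⟧ → P x
  ∈⟦⟧⁻ {x} x∈ = decided (P? x) (trans (sym (lookup∘tabulate _ x)) ([]=⇒lookup x∈))

∣∪∣+∣∩∣ : (p q : Subset n) → ∣ p ∪ q ∣ + ∣ p ∩ q ∣ ≡ ∣ p ∣ + ∣ q ∣
∣∪∣+∣∩∣ [] [] = refl
∣∪∣+∣∩∣ (inside ∷ p) (inside ∷ q) = cong suc (begin
  ∣ p ∪ q ∣ + suc ∣ p ∩ q ∣   ≡⟨ +-suc ∣ p ∪ q ∣ ∣ p ∩ q ∣ ⟩
  suc (∣ p ∪ q ∣ + ∣ p ∩ q ∣) ≡⟨ cong suc (∣∪∣+∣∩∣ p q) ⟩
  suc (∣ p ∣ + ∣ q ∣)         ≡⟨ +-suc ∣ p ∣ ∣ q ∣ ⟨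
  ∣ p ∣ + suc ∣ q ∣           ∎)
  where open ≡-Reasoning
∣∪∣+∣∩∣ (inside ∷ p) (outside ∷ q) = cong suc (∣∪∣+∣∩∣ p q)
∣∪∣+∣∩∣ (outside ∷ p) (inside ∷ q) =
  trans (cong suc (∣∪∣+∣∩∣ p q)) (sym (+-suc ∣ p ∣ ∣ q ∣))
∣∪∣+∣∩∣ (outside ∷ p) (outside ∷ q) = ∣∪∣+∣∩∣ p q

∣∪∣-disjoint : (p q : Subset n) → (∀ {x} → x ∈ p → x ∉ q) → ∣ p ∪ q ∣ ≡ ∣ p ∣ + ∣ q ∣
∣∪∣-disjoint {n} p q disjoint = begin
  ∣ p ∪ q ∣             ≡⟨ +-identityʳ ∣ p ∪ q ∣ ⟨
  ∣ p ∪ q ∣ + 0         ≡⟨ cong (∣ p ∪ q ∣ +_) (∣⊥∣≡0 n) ⟨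
  ∣ p ∪ q ∣ + ∣ ∅ {n} ∣ ≡⟨ cong (λ r → ∣ p ∪ q ∣ + ∣ r ∣) p∩q≡∅ ⟨
  ∣ p ∪ q ∣ + ∣ p ∩ q ∣ ≡⟨ ∣∪∣+∣∩∣ p q ⟩
  ∣ p ∣ + ∣ q ∣         ∎
  where
  open ≡-Reasoning
  p∩q≡∅ : p ∩ q ≡ ∅
  p∩q≡∅ = Empty-unique λ (x , x∈p∩q) → let (x∈p , x∈q) = x∈p∩q⁻ p q x∈p∩q in disjoint x∈p x∈q

∣∩∣+∣∩∁∣ : (p q : Subset n) → ∣ p ∩ q ∣ + ∣ p ∩ ∁ q ∣ ≡ ∣ p ∣
∣∩∣+∣∩∁∣ [] [] = refl
∣∩∣+∣∩∁∣ (inside ∷ p) (inside ∷ q) = cong suc (∣∩∣+∣∩∁∣ p q)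
∣∩∣+∣∩∁∣ (inside ∷ p) (outside ∷ q) = trans (+-suc ∣ p ∩ q ∣ ∣ p ∩ ∁ q ∣) (cong suc (∣∩∣+∣∩∁∣ p q))
∣∩∣+∣∩∁∣ (outside ∷ p) (_ ∷ q) = ∣∩∣+∣∩∁∣ p q

injection⇒≤∣∣ : ∀ {p : Subset n} (f : Fin m → Fin n) → Injective _≡_ _≡_ f → (∀ i → f i ∈ p) → m ≤ ∣ p ∣
injection⇒≤∣∣ {m = zero} f f-inj f∈p = z≤n
injection⇒≤∣∣ {m = suc m} {p = p} f f-inj f∈p =
  <-≤-trans (s≤s (injection⇒≤∣∣ (f ∘ suc) (Fin.suc-injective ∘ f-inj) f∘suc∈p)) (x∈p⇒∣p-x∣<∣p∣ (f∈p zero))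
  where
  f∘suc∈p : ∀ i → f (suc i) ∈ p - f zero
  f∘suc∈p i = x∈p∧x≢y⇒x∈p-y (f∈p (suc i)) (λ eq → Fin.0≢1+n (f-inj (sym eq)))

enumerate : (p : Subset n) → Σ (Fin ∣ p ∣ → Fin n) λ f → Injective _≡_ _≡_ f × (∀ i → f i ∈ p)
enumerate [] = (λ ()) , (λ {}) , λ ()
enumerate (outside ∷ p) with enumerate p
... | f , f-inj , f∈p = suc ∘ f , f-inj ∘ Fin.suc-injective , there ∘ f∈p
enumerate (inside ∷ p) with enumerate p
... | f , f-inj , f∈p = g , g-inj , g∈p
  where
  g : Fin (suc ∣ p ∣) → Fin (suc _)
  g zero = zero
  g (suc i) = suc (f i)
  g-inj : Injective _≡_ _≡_ g
  g-inj {zero} {zero} _ = refl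
  g-inj {suc i} {suc j} eq = cong suc (f-inj (Fin.suc-injective eq))
  g∈p : ∀ i → g i ∈ inside ∷ p
  g∈p zero = here
  g∈p (suc i) = there (f∈p i)

three≤∣∣ : ∀ {p : Subset n} {x y z} → x ∈ p → y ∈ p → z ∈ p → x ≢ y → x ≢ z → y ≢ z → 3 ≤ ∣ p ∣
three≤∣∣ {p = p} {x} {y} {z} x∈p y∈p z∈p x≢y x≢z y≢z = ≤-trans (s≤s two≤) (x∈p⇒∣p-x∣<∣p∣ x∈p)
  where
  y∈p-x : y ∈ p - x
  y∈p-x = x∈p∧x≢y⇒x∈p-y y∈p (x≢y ∘ sym)
  z∈p-x-y : z ∈ p - x - y
  z∈p-x-y = x∈p∧x≢y⇒x∈p-y (x∈p∧x≢y⇒x∈p-y z∈p (x≢z ∘ sym)) (y≢z ∘ sym)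
  two≤ : 2 ≤ ∣ p - x ∣
  two≤ = ≤-trans (s≤s (≤-trans (s≤s z≤n) (x∈p⇒∣p-x∣<∣p∣ z∈p-x-y))) (x∈p⇒∣p-x∣<∣p∣ y∈p-x)

missesAtMostTwo : ∀ {k} {S : Subset k} → 2 ≤ k → ∣ S ∣ ≡ k ∸ 2 → ∀ {x y z} →
                  x ∉ S → y ∉ S → z ∉ S → x ≢ y → x ≢ z → y ≢ z → ⊥
missesAtMostTwo {k} {S} 2≤k ∣S∣≡k∸2 x∉S y∉S z∉S x≢y x≢z y≢z = <⇒≱ (s≤s (s≤s (s≤s z≤n))) (begin
  3               ≤⟨ three≤∣∣ (x∉p⇒x∈∁p x∉S) (x∉p⇒x∈∁p y∉S) (x∉p⇒x∈∁p z∉S) x≢y x≢z y≢z ⟩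
  ∣ ∁ S ∣         ≡⟨ ∣∁p∣≡n∸∣p∣ S ⟩
  k ∸ ∣ S ∣       ≡⟨ cong (k ∸_) ∣S∣≡k∸2 ⟩
  k ∸ (k ∸ 2)     ≡⟨ m∸[m∸n]≡n 2≤k ⟩
  2               ∎)
  where open ≤-Reasoning

avoidingPair : ∀ {k} {p q : Fin k} → p ≢ q → Σ (Subset k) λ S → ∣ S ∣ ≡ k ∸ 2 × p ∉ S × q ∉ S
avoidingPair {k} {p} {q} p≢q =
  ∁ pair , ∣∁pair∣ , x∈p⇒x∉∁p (x∈p∪q⁺ (inj₁ (x∈⁅x⁆ p))) , x∈p⇒x∉∁p (x∈p∪q⁺ (inj₂ (x∈⁅x⁆ q)))
  where
  pair : Subset k
  pair = ⁅ p ⁆ ∪ ⁅ q ⁆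
  ∣∁pair∣ : ∣ ∁ pair ∣ ≡ k ∸ 2
  ∣∁pair∣ = begin
    ∣ ∁ pair ∣                  ≡⟨ ∣∁p∣≡n∸∣p∣ pair ⟩
    k ∸ ∣ pair ∣                ≡⟨ cong (k ∸_) (∣∪∣-disjoint ⁅ p ⁆ ⁅ q ⁆ λ x∈⁅p⁆ x∈⁅q⁆ →
                                     p≢q (trans (sym (x∈⁅y⁆⇒x≡y p x∈⁅p⁆)) (x∈⁅y⁆⇒x≡y q x∈⁅q⁆))) ⟩
    k ∸ (∣ ⁅ p ⁆ ∣ + ∣ ⁅ q ⁆ ∣) ≡⟨ cong₂ (λ i j → k ∸ (i + j)) (∣⁅x⁆∣≡1 p) (∣⁅x⁆∣≡1 q) ⟩
    k ∸ 2                       ∎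
    where open ≡-Reasoning

otherThan : ∀ {k} → 2 ≤ k → (p : Fin k) → ∃ λ q → p ≢ q
otherThan (s≤s (s≤s _)) zero = suc zero , λ ()
otherThan (s≤s (s≤s _)) (suc p) = zero , λ ()

avoidingTwo : ∀ {k} → 2 ≤ k → (p q : Fin k) → Σ (Subset k) λ S → ∣ S ∣ ≡ k ∸ 2 × p ∉ S × q ∉ S
avoidingTwo 2≤k p q with p Fin.≟ q
... | no p≢q = avoidingPair p≢q
... | yes refl with avoidingPair (proj₂ (otherThan 2≤k p))
...   | S , ∣S∣≡k∸2 , p∉S , _ = S , ∣S∣≡k∸2 , p∉S , p∉S

allButTwo : ∀ {m k} {ℓ : Fin (suc m) → Fin k} → Injective _≡_ _≡_ ℓ → 2 ≤ k →
            ∀ {S} → ∣ S ∣ ≡ k ∸ 2 → ∃₂ λ x y → ∀ v → v ≢ x → v ≢ y → ℓ v ∈ S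
allButTwo {ℓ = ℓ} ℓ-inj 2≤k {S} ∣S∣≡k∸2 with Fin.any? (λ v → ¬? (ℓ v ∈? S))
... | no none = zero , zero , λ v _ _ → decidable-stable (ℓ v ∈? S) (none ∘ (v ,_))
... | yes (x , ℓx∉S) with Fin.any? (λ v → ¬? (v Fin.≟ x) ×-dec ¬? (ℓ v ∈? S))
...   | no none = x , x , λ v v≢x _ → decidable-stable (ℓ v ∈? S) (λ ℓv∉S → none (v , v≢x , ℓv∉S))
...   | yes (y , y≢x , ℓy∉S) = x , y , λ v v≢x v≢y → decidable-stable (ℓ v ∈? S) λ ℓv∉S →
  missesAtMostTwo 2≤k ∣S∣≡k∸2 ℓv∉S ℓx∉S ℓy∉S (v≢x ∘ ℓ-inj) (v≢y ∘ ℓ-inj) (y≢x ∘ sym ∘ ℓ-inj)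

module LowerBound {k n : ℕ} (G : KPartiteGraph k n) where

  adj-irrefl : ∀ v → adj G v v ≢ true
  adj-irrefl v vv = adj-parts G v v vv refl

  IsCliqueSet : Subset n → Set
  IsCliqueSet P = ∀ {u v} → u ∈ P → v ∈ P → u ≢ v → adj G u v ≡ true

  clique-injective : ∀ {m} {K : Fin m → Fin n} → IsClique G m K → Injective _≡_ _≡_ K
  clique-injective {K = K} isClique {i} {j} Ki≡Kj with i Fin.≟ j
  ... | yes i≡j = i≡j
  ... | no i≢j = contradiction (subst (λ w → adj G (K i) w ≡ true) (sym Ki≡Kj) (isClique i j i≢j))
                                (adj-irrefl (K i))

  inImage? : ∀ {m} (K : Fin m → Fin n) → Decidable (λ v → ∃ λ i → K i ≡ v)
  inImage? K v = Fin.any? (λ i → K i Fin.≟ v)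

  image : ∀ {m} → (Fin m → Fin n) → Subset n
  image K = ⟦ inImage? K ⟧

  image-clique : ∀ {m} {K : Fin m → Fin n} → IsClique G m K → IsCliqueSet (image K) × m ≤ ∣ image K ∣
  image-clique {K = K} isClique =
    isCliqueSet , injection⇒≤∣∣ K (clique-injective isClique) (λ i → ∈⟦⟧⁺ (inImage? K) (i , refl))
    where
    isCliqueSet : IsCliqueSet (image K)
    isCliqueSet u∈ v∈ u≢v with ∈⟦⟧⁻ (inImage? K) u∈ | ∈⟦⟧⁻ (inImage? K) v∈
    ... | i , refl | j , refl = isClique i j (λ i≡j → u≢v (cong K i≡j))

  cliqueSet-bound : ∀ {a} → KFree G (suc a) → ∀ {P} → IsCliqueSet P → ∣ P ∣ ≤ a
  cliqueSet-bound {a} free {P} isCliqueSet with ∣ P ∣ ≤? a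
  ... | yes ∣P∣≤a = ∣P∣≤a
  ... | no ∣P∣≰a = contradiction (K , isClique) free
    where
    a<∣P∣ : suc a ≤ ∣ P ∣
    a<∣P∣ = ≰⇒> ∣P∣≰a
    listing = enumerate P
    K : Fin (suc a) → Fin n
    K i = proj₁ listing (inject≤ i a<∣P∣)
    isClique : IsClique G (suc a) K
    isClique i j i≢j = isCliqueSet (proj₂ (proj₂ listing) _) (proj₂ (proj₂ listing) _)
      (i≢j ∘ Fin.inject≤-injective a<∣P∣ a<∣P∣ i j ∘ proj₁ (proj₂ listing))

  module Hall {a : ℕ} (free : KFree G (suc a)) (z : Fin n)
              (avoider : ∀ c → Σ (Subset n) λ K → IsCliqueSet K × a ≤ ∣ K ∣ × z ∉ K × c ∉ K) where

    NonNbr : Subset n → Fin n → Set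
    NonNbr S w = w ≢ z × w ∉ S × ∃ λ s → s ∈ S × adj G s w ≢ true

    nonNbr? : ∀ S → Decidable (NonNbr S)
    nonNbr? S w =
      ¬? (w Fin.≟ z) ×-dec ¬? (w ∈? S) ×-dec Fin.any? (λ s → s ∈? S ×-dec ¬? (adj G s w Bool.≟ true))

    nonNbrs : Subset n → Subset n
    nonNbrs S = ⟦ nonNbr? S ⟧

    nonNbr-outside : ∀ {U P w} → IsCliqueSet P → U ⊆ P → NonNbr U w → w ∉ P
    nonNbr-outside isCliqueP U⊆P (_ , w∉U , s , s∈U , s≁w) w∈P =
      s≁w (isCliqueP (U⊆P s∈U) w∈P (λ s≡w → w∉U (subst (_∈ _) s≡w s∈U)))

    nonNbrs-shrink : ∀ {S K} → IsCliqueSet S → IsCliqueSet K → nonNbrs (S ∩ K) ⊆ nonNbrs S ∩ ∁ K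
    nonNbrs-shrink {S} {K} isCliqueS isCliqueK w∈ with ∈⟦⟧⁻ (nonNbr? (S ∩ K)) w∈
    ... | nonNbr@(w≢z , _ , s , s∈S∩K , s≁w) = x∈p∩q⁺
      ( ∈⟦⟧⁺ (nonNbr? S) (w≢z , nonNbr-outside isCliqueS (p∩q⊆p S K) nonNbr , s , p∩q⊆p S K s∈S∩K , s≁w)
      , x∉p⇒x∈∁p (nonNbr-outside isCliqueK (p∩q⊆q S K) nonNbr) )

    joined : ∀ {S K u v} → IsCliqueSet S → z ∉ K → u ∈ K → u ∉ nonNbrs S → v ∈ S → u ≢ v → adj G u v ≡ true
    joined {S} {K} {u} {v} isCliqueS z∉K u∈K u∉nonNbrs v∈S u≢v with u ∈? S | adj G v u Bool.≟ true
    ... | yes u∈S | _ = isCliqueS u∈S v∈S u≢v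
    ... | no _ | yes v~u = trans (adj-sym G u v) v~u
    ... | no u∉S | no v≁u = contradiction (∈⟦⟧⁺ (nonNbr? S) (u≢z , u∉S , v , v∈S , v≁u)) u∉nonNbrs
      where
      u≢z : u ≢ z
      u≢z u≡z = z∉K (subst (_∈ K) u≡z u∈K)

    exchange-clique : ∀ {S K} → IsCliqueSet S → IsCliqueSet K → z ∉ K →
                      IsCliqueSet ((K ∩ ∁ (nonNbrs S)) ∪ (S ∩ ∁ K))
    exchange-clique {S} {K} isCliqueS isCliqueK z∉K {u} {v} u∈ v∈ u≢v
      with x∈p∪q⁻ (K ∩ ∁ (nonNbrs S)) _ u∈ | x∈p∪q⁻ (K ∩ ∁ (nonNbrs S)) _ v∈
    ... | inj₁ u∈K∖N | inj₁ v∈K∖N = isCliqueK (p∩q⊆p _ _ u∈K∖N) (p∩q⊆p _ _ v∈K∖N) u≢v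
    ... | inj₂ u∈S∖K | inj₂ v∈S∖K = isCliqueS (p∩q⊆p _ _ u∈S∖K) (p∩q⊆p _ _ v∈S∖K) u≢v
    ... | inj₁ u∈K∖N | inj₂ v∈S∖K =
      joined isCliqueS z∉K (p∩q⊆p _ _ u∈K∖N) (x∈∁p⇒x∉p (p∩q⊆q _ _ u∈K∖N)) (p∩q⊆p _ _ v∈S∖K) u≢v
    ... | inj₂ u∈S∖K | inj₁ v∈K∖N = trans (adj-sym G u v)
      (joined isCliqueS z∉K (p∩q⊆p _ _ v∈K∖N) (x∈∁p⇒x∉p (p∩q⊆q _ _ v∈K∖N)) (p∩q⊆p _ _ u∈S∖K) (u≢v ∘ sym))

    exchange-count : ∀ {S K} → IsCliqueSet S → IsCliqueSet K → a ≤ ∣ K ∣ → z ∉ K →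
                     ∣ S ∩ ∁ K ∣ ≤ ∣ nonNbrs S ∩ K ∣
    exchange-count {S} {K} isCliqueS isCliqueK a≤∣K∣ z∉K =
      +-cancelˡ-≤ (∣ K ∩ ∁ N ∣) _ _ (begin
        ∣ K ∩ ∁ N ∣ + ∣ S ∩ ∁ K ∣ ≡⟨ ∣∪∣-disjoint (K ∩ ∁ N) (S ∩ ∁ K) disjoint ⟨
        ∣ K′ ∣                    ≤⟨ cliqueSet-bound free (exchange-clique isCliqueS isCliqueK z∉K) ⟩
        a                         ≤⟨ a≤∣K∣ ⟩
        ∣ K ∣                     ≡⟨ ∣∩∣+∣∩∁∣ K N ⟨
        ∣ K ∩ N ∣ + ∣ K ∩ ∁ N ∣   ≡⟨ cong₂ _+_ (cong ∣_∣ (∩-comm K N)) refl ⟩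
        ∣ N ∩ K ∣ + ∣ K ∩ ∁ N ∣   ≡⟨ +-comm (∣ N ∩ K ∣) _ ⟩
        ∣ K ∩ ∁ N ∣ + ∣ N ∩ K ∣   ∎)
      where
      open ≤-Reasoning
      N = nonNbrs S
      K′ = (K ∩ ∁ N) ∪ (S ∩ ∁ K)
      disjoint : ∀ {x} → x ∈ K ∩ ∁ N → x ∉ S ∩ ∁ K
      disjoint x∈K∖N x∈S∖K = x∈∁p⇒x∉p (p∩q⊆q S (∁ K) x∈S∖K) (p∩q⊆p K (∁ N) x∈K∖N)

    -- Hall's condition: every clique set has at least as many non-neighbours as vertices.
    -- By well-founded induction on S: exchange along a clique set avoiding a vertex of S.
    hall : ∀ {S} → IsCliqueSet S → ∣ S ∣ ≤ ∣ nonNbrs S ∣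
    hall {S} = go S (⊂-wellFounded S)
      where
      go : ∀ S → Acc _⊂_ S → IsCliqueSet S → ∣ S ∣ ≤ ∣ nonNbrs S ∣
      go S (acc smaller) isCliqueS with nonempty? S
      ... | no empty = ≤-trans (≤-reflexive (trans (cong ∣_∣ (Empty-unique empty)) (∣⊥∣≡0 n))) z≤n
      ... | yes (c , c∈S) with avoider c
      ...   | K , isCliqueK , a≤∣K∣ , z∉K , c∉K = begin
        ∣ S ∣                           ≡⟨ ∣∩∣+∣∩∁∣ S K ⟨
        ∣ S ∩ K ∣ + ∣ S ∩ ∁ K ∣         ≤⟨ +-mono-≤ hall-S∩K (exchange-count isCliqueS isCliqueK a≤∣K∣ z∉K) ⟩
        ∣ nonNbrs (S ∩ K) ∣ + ∣ N ∩ K ∣ ≤⟨ +-monoˡ-≤ ∣ N ∩ K ∣ nonNbrs-S∩K≤ ⟩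
        ∣ N ∩ ∁ K ∣ + ∣ N ∩ K ∣         ≡⟨ +-comm (∣ N ∩ ∁ K ∣) _ ⟩
        ∣ N ∩ K ∣ + ∣ N ∩ ∁ K ∣         ≡⟨ ∣∩∣+∣∩∁∣ N K ⟩
        ∣ N ∣                           ∎
        where
        open ≤-Reasoning
        N = nonNbrs S
        S∩K⊂S : S ∩ K ⊂ S
        S∩K⊂S = p∩q⊆p S K , c , c∈S , λ c∈S∩K → c∉K (p∩q⊆q S K c∈S∩K)
        hall-S∩K : ∣ S ∩ K ∣ ≤ ∣ nonNbrs (S ∩ K) ∣
        hall-S∩K = go (S ∩ K) (smaller S∩K⊂S) (λ u∈ v∈ → isCliqueS (p∩q⊆p S K u∈) (p∩q⊆p S K v∈))
        nonNbrs-S∩K≤ : ∣ nonNbrs (S ∩ K) ∣ ≤ ∣ N ∩ ∁ K ∣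
        nonNbrs-S∩K≤ = p⊆q⇒∣p∣≤∣q∣ (nonNbrs-shrink isCliqueS isCliqueK)

    -- Consequently the graph has more than 2a vertices: a clique set avoiding z and
    -- its non-neighbours are disjoint sets of size ≥ a missing z.
    vertex-bound : a + a < n
    vertex-bound with avoider z
    ... | S , isCliqueS , a≤∣S∣ , z∉S , _ = begin-strict
      a + a                     ≤⟨ +-mono-≤ a≤∣S∣ (≤-trans a≤∣S∣ (hall isCliqueS)) ⟩
      ∣ S ∣ + ∣ N ∣             ≡⟨ ∣∪∣-disjoint S N (λ x∈S x∈N → proj₁ (proj₂ (∈⟦⟧⁻ (nonNbr? S) x∈N)) x∈S) ⟨
      ∣ S ∪ N ∣                 ≤⟨ p⊆q⇒∣p∣≤∣q∣ S∪N⊆∁z ⟩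
      ∣ ∁ ⁅ z ⁆ ∣               ≡⟨ ∣∁p∣≡n∸∣p∣ ⁅ z ⁆ ⟩
      n ∸ ∣ ⁅ z ⁆ ∣             ≡⟨ cong (n ∸_) (∣⁅x⁆∣≡1 z) ⟩
      n ∸ 1                     <⟨ ∸-monoʳ-< (s≤s z≤n) (≤-trans (s≤s z≤n) (Fin.toℕ<n z)) ⟩
      n                         ∎
      where
      open ≤-Reasoning
      N = nonNbrs S
      S∪N⊆∁z : S ∪ N ⊆ ∁ ⁅ z ⁆
      S∪N⊆∁z x∈S∪N with x∈p∪q⁻ S N x∈S∪N
      ... | inj₁ x∈S = x∉p⇒x∈∁p λ x∈⁅z⁆ → z∉S (subst (_∈ S) (x∈⁅y⁆⇒x≡y z x∈⁅z⁆) x∈S)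
      ... | inj₂ x∈N = x∉p⇒x∈∁p λ x∈⁅z⁆ → proj₁ (∈⟦⟧⁻ (nonNbr? S) x∈N) (x∈⁅y⁆⇒x≡y z x∈⁅z⁆)

  -- Lower bound: if G witnesses β₂(k, a+1) with a ≥ 1, then G has more than 2a vertices.
  -- Removing the parts of any two vertices z, c leaves a K_a, which avoids z and c.
  lower-bound : ∀ {a} → 1 ≤ a → 2 ≤ k → BetaWitness 2 k (suc a) G → a + a < n
  lower-bound {suc b} _ 2≤k (free , cliques) = Hall.vertex-bound free z avoider
    where
    cliqueAvoiding : ∀ (p q : Fin k) → Σ (Fin (suc b) → Fin n) λ K →
                     IsClique G (suc b) K × (∀ i → part G (K i) ≢ p) × (∀ i → part G (K i) ≢ q)
    cliqueAvoiding p q with avoidingTwo 2≤k p q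
    ... | S , ∣S∣≡k∸2 , p∉S , q∉S with cliques S ∣S∣≡k∸2
    ...   | K , isClique , K∈S = K , isClique , (λ i Ki≡p → p∉S (subst (_∈ S) Ki≡p (K∈S i)))
                                              , (λ i Ki≡q → q∉S (subst (_∈ S) Ki≡q (K∈S i)))
    -- Some vertex exists, as cliques of size a ≥ 1 do.
    z : Fin n
    z = proj₁ (cliqueAvoiding (fromℕ< 2≤k) (fromℕ< 2≤k)) zero
    avoider : ∀ c → Σ (Subset n) λ K → IsCliqueSet K × suc b ≤ ∣ K ∣ × z ∉ K × c ∉ K
    avoider c with cliqueAvoiding (part G z) (part G c)
    ... | K , isClique , K≁z , K≁c = image K , proj₁ (image-clique isClique) , proj₂ (image-clique isClique)
        , (λ z∈ → let (i , Ki≡z) = ∈⟦⟧⁻ (inImage? K) z∈ in K≁z i (cong (part G) Ki≡z))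
        , (λ c∈ → let (i , Ki≡c) = ∈⟦⟧⁻ (inImage? K) c∈ in K≁c i (cong (part G) Ki≡c))

twice : ℕ → ℕ
twice zero = zero
twice (suc n) = suc (suc (twice n))

twice≡+ : ∀ n → twice n ≡ n + n
twice≡+ zero = refl
twice≡+ (suc n) = cong suc (trans (cong suc (twice≡+ n)) (sym (+-suc n n)))

twice-mono : ∀ {i j} → i ≤ j → twice i ≤ twice j
twice-mono z≤n = z≤n
twice-mono (s≤s i≤j) = s≤s (s≤s (twice-mono i≤j))

bit : Bool → ℕ
bit false = 0
bit true = 1

bit≤1 : ∀ s → bit s ≤ 1
bit≤1 false = z≤n
bit≤1 true = ≤-refl

parity : ∀ m → ∃₂ λ q e → m ≡ twice q + bit e
parity zero = zero , false , refl
parity (suc zero) = zero , true , refl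
parity (suc (suc m)) with parity m
... | q , e , m≡ = suc q , e , cong (λ x → suc (suc x)) m≡

parity-unique : ∀ i s q e → twice i + bit s ≡ twice q + bit e → i ≡ q × s ≡ e
parity-unique zero false zero false _ = refl , refl
parity-unique zero true zero true _ = refl , refl
parity-unique (suc i) s (suc q) e eq with parity-unique i s q e (suc-injective (suc-injective eq))
... | refl , refl = refl , refl
parity-unique zero false zero true ()
parity-unique zero true zero false ()
parity-unique zero false (suc q) e ()
parity-unique zero true (suc q) e ()
parity-unique (suc i) s zero false ()
parity-unique (suc i) s zero true ()

⌊/2⌋<  : ∀ m c → m < twice c → ⌊ m /2⌋ < c
⌊/2⌋< m zero ()
⌊/2⌋< zero (suc c) _ = s≤s z≤n
⌊/2⌋< (suc zero) (suc c) _ = s≤s z≤n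
⌊/2⌋< (suc (suc m)) (suc c) (s≤s (s≤s m<2c)) = s≤s (⌊/2⌋< m c m<2c)

⌊/2⌋-same : ∀ m n → ⌊ m /2⌋ ≡ ⌊ n /2⌋ → m ≢ n → suc m ≡ n ⊎ suc n ≡ m
⌊/2⌋-same zero zero _ m≢n = contradiction refl m≢n
⌊/2⌋-same zero (suc zero) _ _ = inj₁ refl
⌊/2⌋-same (suc zero) zero _ _ = inj₂ refl
⌊/2⌋-same (suc zero) (suc zero) _ m≢n = contradiction refl m≢n
⌊/2⌋-same (suc (suc m)) (suc (suc n)) eq m≢n
  with ⌊/2⌋-same m n (suc-injective eq) (m≢n ∘ cong (λ x → suc (suc x)))
... | inj₁ sm≡n = inj₁ (cong (λ x → suc (suc x)) sm≡n)
... | inj₂ sn≡m = inj₂ (cong (λ x → suc (suc x)) sn≡m)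
⌊/2⌋-same zero (suc (suc n)) () _
⌊/2⌋-same (suc zero) (suc (suc n)) () _
⌊/2⌋-same (suc (suc m)) zero () _
⌊/2⌋-same (suc (suc m)) (suc zero) () _

consecutive-pair : ∀ m (v : Fin (suc m) → ℕ) → (∀ i → v i < twice m) →
                   (∀ {i j} → v i ≡ v j → i ≡ j) → ∃₂ λ i j → suc (v i) ≡ v j
consecutive-pair m v v<2m v-inj =
  let (i , j , i<j , half≡) = Fin.pigeonhole (n<1+n m) half
  in [ (λ vi+1≡vj → i , j , vi+1≡vj) , (λ vj+1≡vi → j , i , vj+1≡vi) ]′
       (⌊/2⌋-same (v i) (v j) (halves≡ half≡) (Fin.<⇒≢ i<j ∘ v-inj))
  where
  half : Fin (suc m) → Fin m
  half i = fromℕ< (⌊/2⌋< (v i) m (v<2m i))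
  halves≡ : ∀ {i j} → half i ≡ half j → ⌊ v i /2⌋ ≡ ⌊ v j /2⌋
  halves≡ half≡ = trans (sym (Fin.toℕ-fromℕ< _)) (trans (cong toℕ half≡) (Fin.toℕ-fromℕ< _))

module OddCycle (b : ℕ) where

  a top : ℕ
  a = suc b
  top = twice a

  CycleEdge : ℕ → ℕ → Set
  CycleEdge m n = suc m ≡ n ⊎ suc n ≡ m ⊎ (m ≡ 0 × n ≡ top) ⊎ (n ≡ 0 × m ≡ top)

  -- m and n are distinct and not joined: adjacent in the complement of the cycle.
  Apart : ℕ → ℕ → Set
  Apart m n = m ≢ n × ¬ CycleEdge m n

  apart? : ∀ m n → Dec (Apart m n)
  apart? m n = ¬? (m ≟ n) ×-dec
    ¬? (suc m ≟ n ⊎-dec suc n ≟ m ⊎-dec (m ≟ 0 ×-dec n ≟ top) ⊎-dec (n ≟ 0 ×-dec m ≟ top))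

  Apart-sym : ∀ {m n} → Apart m n → Apart n m
  Apart-sym (m≢n , ¬edge) = m≢n ∘ sym , ¬edge ∘ flip
    where
    flip : ∀ {m n} → CycleEdge m n → CycleEdge n m
    flip (inj₁ e) = inj₂ (inj₁ e)
    flip (inj₂ (inj₁ e)) = inj₁ e
    flip (inj₂ (inj₂ (inj₁ e))) = inj₂ (inj₂ (inj₂ e))
    flip (inj₂ (inj₂ (inj₂ e))) = inj₂ (inj₂ (inj₁ e))

  module ApartFamily {m : ℕ} (v : Fin m → ℕ) (apart : ∀ {i j} → i ≢ j → Apart (v i) (v j)) where

    injective : ∀ {i j} → v i ≡ v j → i ≡ j
    injective {i} {j} vi≡vj with i Fin.≟ j
    ... | yes i≡j = i≡j
    ... | no i≢j = contradiction vi≡vj (proj₁ (apart i≢j))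

    no-consecutive : ∀ {i j} → suc (v i) ≢ v j
    no-consecutive {i} {j} vi+1≡vj = proj₂ (apart i≢j) (inj₁ vi+1≡vj)
      where
      i≢j : i ≢ j
      i≢j refl = 1+n≢n vi+1≡vj

  -- If 2a is not used, two of them are consecutive
  -- below 2a; if 2a is used, the others lie in 1 … 2a-2 and two of those are consecutive.
  no-large-apart : (v : Fin (suc a) → ℕ) → (∀ i → v i ≤ top) → (∀ {i j} → i ≢ j → Apart (v i) (v j)) → ⊥
  no-large-apart v v≤top apart with Fin.any? (λ i → v i ≟ top)
  ... | no top∉v =
    let (i , j , vi+1≡vj) = consecutive-pair a v (λ i → ≤∧≢⇒< (v≤top i) (top∉v ∘ (i ,_))) injective
    in no-consecutive vi+1≡vj
    where open ApartFamily v apart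
  ... | yes (i₀ , vi₀≡top) =
    let (i , j , wi+1≡wj) = consecutive-pair b w w<2b w-injective
    in no-consecutive (trans (cong suc (u≡1+w i)) (trans (cong suc wi+1≡wj) (sym (u≡1+w j))))
    where
    u : Fin a → ℕ
    u = v ∘ punchIn i₀
    open ApartFamily u (λ i≢j → apart (i≢j ∘ Fin.punchIn-injective i₀ _ _))
    -- Being apart from v i₀ = 2a, each u j lies between 1 and 2a - 2.
    inner : ∀ j → ∃ λ w → u j ≡ suc w × w < twice b
    inner j = below (u j) (v≤top _) (proj₁ apart-top) (proj₂ apart-top ∘ inj₁)
                    (λ uj≡0 → proj₂ apart-top (inj₂ (inj₂ (inj₁ (uj≡0 , refl)))))
      where
      apart-top : Apart (u j) top
      apart-top = subst (Apart (u j)) vi₀≡top (apart (Fin.punchInᵢ≢i i₀ j))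
      below : ∀ x → x ≤ top → x ≢ top → suc x ≢ top → x ≢ 0 → ∃ λ w → x ≡ suc w × w < twice b
      below zero _ _ _ x≢0 = contradiction refl x≢0
      below (suc w) x≤top x≢top x+1≢top _ = w , refl , s≤s⁻¹ (s≤s⁻¹ (≤∧≢⇒< (≤∧≢⇒< x≤top x≢top) x+1≢top))
    w : Fin a → ℕ
    w j = proj₁ (inner j)
    u≡1+w : ∀ j → u j ≡ suc (w j)
    u≡1+w j = proj₁ (proj₂ (inner j))
    w<2b : ∀ j → w j < twice b
    w<2b j = proj₂ (proj₂ (inner j))
    w-injective : ∀ {i j} → w i ≡ w j → i ≡ j
    w-injective {i} {j} wi≡wj = injective (trans (u≡1+w i) (trans (cong suc wi≡wj) (sym (u≡1+w j))))

  -- The a-element independent sets used as cliques: with a start bit s and a threshold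
  -- t, the i-th element is 2i + s for i < t and 2i + s + 1 for i ≥ t.
  -- jump t i is the indicator of t ≤ i.
  jump : ℕ → ℕ → ℕ
  jump t i with t ≤? i
  ... | yes _ = 1
  ... | no _ = 0

  transversal : Bool → ℕ → ℕ → ℕ
  transversal s t i = twice i + bit s + jump t i

  jump≤1 : ∀ t i → jump t i ≤ 1
  jump≤1 t i with t ≤? i
  ... | yes _ = ≤-refl
  ... | no _ = z≤n

  jump-mono : ∀ t {i j} → i ≤ j → jump t i ≤ jump t j
  jump-mono t {i} {j} i≤j with t ≤? i | t ≤? j
  ... | yes _ | yes _ = ≤-refl
  ... | yes t≤i | no t≰j = contradiction (≤-trans t≤i i≤j) t≰j
  ... | no _ | _ = z≤n

  transversal-gap : ∀ s t {i j} → i < j → suc (suc (transversal s t i)) ≤ transversal s t j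
  transversal-gap s t {i} i<j = +-mono-≤ (+-monoˡ-≤ (bit s) (twice-mono i<j)) (jump-mono t (<⇒≤ i<j))

  transversal-bound : ∀ s t {i} → i < a → transversal s t i ≤ top
  transversal-bound s t {i} i<a = begin
    twice i + bit s + jump t i ≤⟨ +-mono-≤ (+-monoʳ-≤ (twice i) (bit≤1 s)) (jump≤1 t i) ⟩
    twice i + 1 + 1           ≡⟨ trans (+-assoc (twice i) 1 1) (+-comm (twice i) 2) ⟩
    twice (suc i)             ≤⟨ twice-mono i<a ⟩
    top                       ∎
    where open ≤-Reasoning

  transversal-zero : ∀ s t i → transversal s t i ≡ 0 → s ≡ false
  transversal-zero false t i _ = refl
  transversal-zero true t zero ()
  transversal-zero true t (suc i) ()

  transversal-top : ∀ s t {i} → i < a → transversal s t i ≡ top → s ≡ true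
  transversal-top true t _ _ = refl
  transversal-top false t {i} i<a Ti≡top = contradiction Ti≡top (<⇒≢ (begin-strict
    twice i + 0 + jump t i ≤⟨ +-mono-≤ (≤-reflexive (+-identityʳ (twice i))) (jump≤1 t i) ⟩
    twice i + 1            <⟨ ≤-reflexive (cong suc (+-comm (twice i) 1)) ⟩
    twice (suc i)          ≤⟨ twice-mono i<a ⟩
    top                    ∎))
    where open ≤-Reasoning

  transversal-apart : ∀ s t {i j} → i < j → j < a → Apart (transversal s t i) (transversal s t j)
  transversal-apart s t {i} {j} i<j j<a = <⇒≢ (≤-trans (n≤1+n _) gap) , ¬edge
    where
    gap = transversal-gap s t i<j
    ¬edge : ¬ CycleEdge (transversal s t i) (transversal s t j)
    ¬edge (inj₁ Ti+1≡Tj) = <-irrefl Ti+1≡Tj gap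
    ¬edge (inj₂ (inj₁ Tj+1≡Ti)) = <-asym (≤-trans (n≤1+n _) gap) (≤-reflexive Tj+1≡Ti)
    ¬edge (inj₂ (inj₂ (inj₁ (Ti≡0 , Tj≡top))))
      with trans (sym (transversal-zero s t i Ti≡0)) (transversal-top s t j<a Tj≡top)
    ... | ()
    ¬edge (inj₂ (inj₂ (inj₂ (Tj≡0 , _)))) with ≤-trans gap (≤-reflexive Tj≡0)
    ... | ()

  -- When the transversal (s, t) misses the number 2q + e: either e = s and it lies
  -- from the threshold on, or e ≠ s and it lies below the threshold.
  Misses : Bool → ℕ → ℕ → Bool → Set
  Misses s t q e = (e ≡ s × t ≤ q) ⊎ (e ≢ s × q + bit e ≤ t)

  misses : ∀ {s t q e} → Misses s t q e → ∀ i → transversal s t i ≢ twice q + bit e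
  misses {s} {t} {q} {e} m i Ti≡ with t ≤? i
  misses {false} {t} {q} {e} m i Ti≡ | yes t≤i
    with parity-unique i true q e (trans (cong (_+ 1) (sym (+-identityʳ (twice i)))) Ti≡)
  ... | refl , refl with m
  ...   | inj₁ (() , _)
  ...   | inj₂ (_ , i+1≤t) = <-irrefl refl (≤-trans (subst (_≤ t) (+-comm i 1) i+1≤t) t≤i)
  misses {true} {t} {q} {e} m i Ti≡ | yes t≤i with parity-unique (suc i) false q e (trans twice-suc Ti≡)
    where
    twice-suc : twice (suc i) + 0 ≡ twice i + 1 + 1
    twice-suc = trans (+-identityʳ _) (sym (trans (+-assoc (twice i) 1 1) (+-comm (twice i) 2)))
  ... | refl , refl with m
  ...   | inj₁ (() , _)
  ...   | inj₂ (_ , i+1≤t) = <-irrefl refl (≤-trans (subst (_≤ t) (+-identityʳ (suc i)) i+1≤t) t≤i)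
  misses {s} {q = q} {e} m i Ti≡ | no t≰i with parity-unique i s q e (trans (sym (+-identityʳ _)) Ti≡)
  ... | refl , refl with m
  ...   | inj₁ (_ , t≤i) = t≰i t≤i
  ...   | inj₂ (s≢s , _) = s≢s refl

  choose : ∀ qx ex qy ey → ∃₂ λ s t → Misses s t qx ex × Misses s t qy ey
  choose qx false qy false =
    true , qx + qy , inj₂ ((λ ()) , subst (_≤ qx + qy) (sym (+-identityʳ qx)) (m≤m+n qx qy))
                   , inj₂ ((λ ()) , subst (_≤ qx + qy) (sym (+-identityʳ qy)) (m≤n+m qy qx))
  choose qx true qy true = true , 0 , inj₁ (refl , z≤n) , inj₁ (refl , z≤n)
  choose qx false qy true with qx ≤? qy
  ... | yes qx≤qy = true , qx , inj₂ ((λ ()) , ≤-reflexive (+-identityʳ qx)) , inj₁ (refl , qx≤qy)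
  ... | no qx≰qy = false , qx , inj₁ (refl , ≤-refl) , inj₂ ((λ ()) , subst (_≤ qx) (+-comm 1 qy) (≰⇒> qx≰qy))
  choose qx true qy false with choose qy false qx true
  ... | s , t , misses-y , misses-x = s , t , misses-x , misses-y

module AntiCycle (b k : ℕ) (N≤k : suc (twice (suc b)) ≤ k) where
  open OddCycle b

  N : ℕ
  N = suc top

  antiCycle : KPartiteGraph k N
  antiCycle = record
    { part = λ v → inject≤ v N≤k
    ; adj = λ u v → does (apart? (toℕ u) (toℕ v))
    ; adj-sym = λ u v → does-⇔ (mk⇔ Apart-sym Apart-sym) (apart? (toℕ u) (toℕ v)) (apart? (toℕ v) (toℕ u))
    ; adj-parts = λ u v u~v pu≡pv →
        proj₁ (decided (apart? (toℕ u) (toℕ v)) u~v) (cong toℕ (Fin.inject≤-injective N≤k N≤k u v pu≡pv))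
    }

  apart-of-adj : ∀ {u v} → adj antiCycle u v ≡ true → Apart (toℕ u) (toℕ v)
  apart-of-adj {u} {v} = decided (apart? (toℕ u) (toℕ v))

  -- A clique is a pairwise-apart family of numbers ≤ 2a, of which there are at most a.
  free : KFree antiCycle (suc a)
  free (f , isClique) =
    no-large-apart (toℕ ∘ f) (λ i → s≤s⁻¹ (Fin.toℕ<n (f i))) (λ i≢j → apart-of-adj (isClique _ _ i≢j))

  module Transversal (s : Bool) (t : ℕ) where
    vertex : Fin a → Fin N
    vertex i = fromℕ< (s≤s (transversal-bound s t (Fin.toℕ<n i)))

    toℕ-vertex : ∀ i → toℕ (vertex i) ≡ transversal s t (toℕ i)
    toℕ-vertex i = Fin.toℕ-fromℕ< _

    isClique : IsClique antiCycle a vertex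
    isClique i j i≢j = dec-true (apart? (toℕ (vertex i)) (toℕ (vertex j)))
                                (subst₂ Apart (sym (toℕ-vertex i)) (sym (toℕ-vertex j)) apart)
      where
      apart : Apart (transversal s t (toℕ i)) (transversal s t (toℕ j))
      apart with <-cmp (toℕ i) (toℕ j)
      ... | tri< i<j _ _ = transversal-apart s t i<j (Fin.toℕ<n j)
      ... | tri≈ _ i≡j _ = contradiction (Fin.toℕ-injective i≡j) i≢j
      ... | tri> _ _ j<i = Apart-sym (transversal-apart s t j<i (Fin.toℕ<n i))

    avoids : ∀ {x q e} → toℕ x ≡ twice q + bit e → Misses s t q e → ∀ i → vertex i ≢ x
    avoids x≡ m i vi≡x = misses m (toℕ i) (trans (sym (toℕ-vertex i)) (trans (cong toℕ vi≡x) x≡))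

  -- Removing any two parts leaves a K_a: the at most two vertices in the removed parts
  -- are missed by a common transversal.
  cliques : ∀ S → ∣ S ∣ ≡ k ∸ 2 → HasCliqueIn antiCycle a S
  cliques S ∣S∣≡k∸2
    with allButTwo (Fin.inject≤-injective N≤k N≤k _ _) (≤-trans (s≤s (s≤s z≤n)) N≤k) ∣S∣≡k∸2
  ... | x , y , inS with parity (toℕ x) | parity (toℕ y)
  ...   | qx , ex , x≡ | qy , ey , y≡ with choose qx ex qy ey
  ...     | s , t , misses-x , misses-y =
    vertex , isClique , λ i → inS (vertex i) (avoids x≡ misses-x i) (avoids y≡ misses-y i)
    where open Transversal s t

β₂ : ∀ b k → suc (twice (suc b)) ≤ k → IsBeta 2 k (suc (suc b)) (suc (twice (suc b)))
β₂ b k N≤k = (antiCycle , free , cliques) , λ n G witness →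
  subst (_< n) (sym (twice≡+ (suc b))) (LowerBound.lower-bound G (s≤s z≤n) 2≤k witness)
  where
  open AntiCycle b k N≤k
  2≤k : 2 ≤ k
  2≤k = ≤-trans (s≤s (s≤s z≤n)) N≤k

corollary3p11 : ∀ (r k : ℕ) → 2 ≤ r → 2 * r ∸ 1 ≤ k → IsBeta 2 k r (2 * r ∸ 1)
corollary3p11 (suc (suc b)) k (s≤s (s≤s _)) N≤k =
  subst (IsBeta 2 k (suc (suc b))) (sym 2r-1≡) (β₂ b k (subst (_≤ k) 2r-1≡ N≤k))
  where
  2r-1≡ : 2 * suc (suc b) ∸ 1 ≡ suc (twice (suc b))
  2r-1≡ = begin
    suc b + suc (suc b + 0) ≡⟨ cong (λ m → suc b + suc m) (+-identityʳ (suc b)) ⟩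
    suc b + suc (suc b)     ≡⟨ +-suc (suc b) (suc b) ⟩
    suc (suc b + suc b)     ≡⟨ cong suc (twice≡+ (suc b)) ⟨
    suc (twice (suc b))     ∎
    where open ≡-Reasoning
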